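{- Let $p\ge2$ be a prime and $\mathbb{X}_p\in\{\mathbb{Z}_p,\mathbb{Q}_p\}$. There exists a continuous map $f:\mathbb{X}_p\to\mathbb{X}_p$ which admits a contraction $R:\mathbb{X}_p\to\mathbb{X}_p$ (i.e. $\mathrm{Lip}(R)<1$) as a right inverse ($f\circ R=\mathrm{id}$), but such that $f$ does not have the shadowing property, is not Lipschitz structurally stable, and is not topologically stable.
   Context: $\mathbb{Z}_p$, $\mathbb{Q}_p$ are the $p$-adic integers and numbers with the $p$-adic norm $\|\cdot\|_p$. $\|\phi\|_\infty=\sup_x\|\phi(x)\|_p$, $\mathrm{Lip}(\phi)=\sup_{x\ne y}\|\phi(x)-\phi(y)\|_p/\|x-y\|_p$, and $\mathrm{Lip}_\delta(\mathbb{X}_p)=\{\phi:\mathbb{X}_p\to\mathbb{X}_p:\mathrm{Lip}(\phi)\le\delta,\ \|\phi\|_\infty\le\delta\}$. A $\delta$-pseudo-orbit of $f$ is a sequence $(x_n)_{n\ge0}$ with $\|f(x_n)-x_{n+1}\|_p\le\delta$ for all $n$. Shadowing: for every $\varepsilon>0$ there is $\delta>0$ such that every $\delta$-pseudo-orbit $(x_n)$ admits $x$ with $\|x_n-f^n(x)\|_p\le\varepsilon$ for all $n\ge0$. Lipschitz structurally stable: there is $\delta>0$ such that for every $\phi\in\mathrm{Lip}_\delta(\mathbb{X}_p)$ there is a homeomorphism $h:\mathbb{X}_p\to\mathbb{X}_p$ with $f\circ h=h\circ(f+\phi)$. Topologically stable: for every $\varepsilon>0$ there is $\delta>0$ such that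 for every continuous $g$ with $\|f-g\|_\infty\le\delta$ there is a continuous $h$ with $\|h-\mathrm{id}\|_\infty\le\varepsilon$ and $f\circ h=h\circ g$. -}

module Defs where

open import Data.Nat as ℕ using (ℕ; zero; suc; _∸_; _<?_; _⊔_)
open import Data.Integer as ℤ using (ℤ; +_; -_; _+_; _-_; ∣_∣)
open import Data.Product using (Σ; ∃; _×_; _,_)
open import Data.Unit using (⊤)
open import Relation.Nullary using (¬_; yes; no)
open import Relation.Binary.PropositionalEquality using (_≡_)

-- An element of ℚ_p is  x = Σ_{i ∈ ℤ} d(i) p^i  with digits 0 ≤ d(i) < p
-- and d(i) = 0 for all i below some bound.  ℤ_p consists of those with
-- d(i) = 0 for all i < 0.

data Space : Set where
  ℤp ℚp : Space

Integral : Space → (ℤ → ℕ) → Set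
Integral ℤp d = ∀ (i : ℤ) → i ℤ.< + 0 → d i ≡ 0
Integral ℚp d = ⊤

record X (p : ℕ) (s : Space) : Set where
  constructor mkX
  field
    digit    : ℤ → ℕ
    digit<p  : ∀ i → digit i ℕ.< p
    bound    : ℕ
    low      : ∀ (i : ℤ) → i ℤ.< - (+ bound) → digit i ≡ 0
    integral : Integral s digit
open X public

-- Closeness of digit functions:  d ≈d[ k ] e  iff  ‖d − e‖_p ≤ p^(−k),
-- i.e. the expansions agree at every position i < k.
_≈d[_]_ : (ℤ → ℕ) → ℤ → (ℤ → ℕ) → Set
d ≈d[ k ] e = ∀ (i : ℤ) → i ℤ.< k → d i ≡ e i

_≈[_]_ : ∀ {p s} → X p s → ℤ → X p s → Set
x ≈[ k ] y = digit x ≈d[ k ] digit y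

_≈_ : ∀ {p s} → X p s → X p s → Set
x ≈ y = ∀ (i : ℤ) → digit x i ≡ digit y i

small : ∀ {p s} → ℤ → X p s → Set
small k x = ∀ (i : ℤ) → i ℤ.< k → digit x i ≡ 0

addStep : ℕ → ℕ → ℕ → ℕ → ℕ × ℕ
addStep p a b c with (a ℕ.+ b ℕ.+ c) <? p
... | yes _ = (a ℕ.+ b ℕ.+ c , 0)
... | no  _ = ((a ℕ.+ b ℕ.+ c) ∸ p , 1)

carry : ℕ → (ℕ → ℕ) → (ℕ → ℕ) → ℕ → ℕ
carry p a b zero = 0
carry p a b (suc n) with addStep p (a n) (b n) (carry p a b n)
... | (_ , c) = c

sumDigit : ℕ → (ℕ → ℕ) → (ℕ → ℕ) → ℕ → ℕ
sumDigit p a b n with addStep p (a n) (b n) (carry p a b n)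
... | (d , _) = d

addDigits : ∀ {p s} → X p s → X p s → ℤ → ℕ
addDigits {p} x y i with i ℤ.<? - (+ M)
  where M = bound x ⊔ bound y
... | yes _ = 0
... | no  _ = sumDigit p (shift x) (shift y) ∣ i + + M ∣
  where
    M = bound x ⊔ bound y
    shift : _ → ℕ → ℕ
    shift z n = digit z (+ n - + M)

iter : ∀ {A : Set} → (A → A) → ℕ → A → A
iter f zero x = x
iter f (suc n) x = f (iter f n x)

Continuous : ∀ {p s} → (X p s → X p s) → Set
Continuous f = ∀ x (k : ℤ) → ∃ λ (j : ℤ) → ∀ y → y ≈[ j ] x → f y ≈[ k ] f x

-- Lip(φ) ≤ p^(−k)
LipLe : ∀ {p s} → ℤ → (X p s → X p s) → Set
LipLe k φ = ∀ x y (j : ℤ) → x ≈[ j ] y → φ x ≈[ j + k ] φ y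

-- Lip(R) < 1  (norms take values in p^ℤ ∪ {0}, so this is Lip(R) ≤ p^(−1))
Contraction : ∀ {p s} → (X p s → X p s) → Set
Contraction R = LipLe (+ 1) R

SupLe : ∀ {p s} → ℤ → (X p s → X p s) → Set
SupLe k φ = ∀ x → small k (φ x)

LipBall : ∀ {p s} → ℤ → (X p s → X p s) → Set
LipBall k φ = LipLe k φ × SupLe k φ

Homeomorphism : ∀ {p s} → (X p s → X p s) → Set
Homeomorphism {p} {s} h =
  Continuous h × Σ (X p s → X p s) λ h⁻¹ →
    Continuous h⁻¹ × (∀ x → h⁻¹ (h x) ≈ x) × (∀ y → h (h⁻¹ y) ≈ y)

PseudoOrbit : ∀ {p s} → (X p s → X p s) → ℤ → (ℕ → X p s) → Set
PseudoOrbit f k xs = ∀ n → f (xs n) ≈[ k ] xs (suc n)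

-- ε, δ range over p^ℤ (equivalent, since all norms lie in p^ℤ ∪ {0})
Shadowing : ∀ {p s} → (X p s → X p s) → Set
Shadowing {p} {s} f =
  ∀ (kε : ℤ) → ∃ λ (kδ : ℤ) → ∀ (xs : ℕ → X p s) → PseudoOrbit f kδ xs →
    ∃ λ (x : X p s) → ∀ n → xs n ≈[ kε ] iter f n x

-- g represents f + φ (the sum is taken in X p s; g is determined up to ≈)
IsSum : ∀ {p s} → (X p s → X p s) → (X p s → X p s) → (X p s → X p s) → Set
IsSum f φ g = ∀ x → ∀ (i : ℤ) → digit (g x) i ≡ addDigits (f x) (φ x) i

LipStructurallyStable : ∀ {p s} → (X p s → X p s) → Set
LipStructurallyStable {p} {s} f =
  ∃ λ (kδ : ℤ) → ∀ (φ g : X p s → X p s) → LipBall kδ φ → IsSum f φ g →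
    Σ (X p s → X p s) λ h → Homeomorphism h × (∀ x → f (h x) ≈ h (g x))

TopologicallyStable : ∀ {p s} → (X p s → X p s) → Set
TopologicallyStable {p} {s} f =
  ∀ (kε : ℤ) → ∃ λ (kδ : ℤ) → ∀ (g : X p s → X p s) → Continuous g →
    (∀ x → f x ≈[ kδ ] g x) →
    Σ (X p s → X p s) λ h → Continuous h × (∀ x → h x ≈[ kε ] x) ×
      (∀ x → f (h x) ≈ h (g x))

{-# OPTIONS --safe #-}
-- On the clopen set {x₁ = 0} (x₁ is the digit of p¹), which contains the image of R, f shifts
-- the digits back, undoing R; the clopen ball {x₁ ≠ 0} is collapsed to the fixed point 0. So
-- ϖ = p has the backward orbit ϖ ← Rϖ ← R²ϖ ← ⋯ with Rᴷϖ → 0, while every point near ϖ falls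
-- into 0 at once and never comes back near ϖ.
--   Shadowing fails: ϖ, Rᴷϖ, …, Rϖ, ϖ, … is a periodic pseudo-orbit, its only jump being
--   f ϖ = 0 ≈ Rᴷϖ.
--   Topological stability fails: the map sending the ball to Rᴷϖ instead of 0 is close to f and
--   has ϖ as a periodic point, so a conjugacy h close to the identity would make the point h ϖ
--   near ϖ f-periodic.
--   Lipschitz structural stability fails because local injectivity is a conjugacy invariant:
--   f is not locally injective at ϖ, but adding p^M times the integral part of x on the ball
--   gives a map that is injective on every ball of radius p⁻².
module Submission where

open import Defs
open import Data.Nat as ℕ using (ℕ; zero; suc; z≤n; s≤s)
import Data.Nat.Properties as ℕₚ
open import Data.Nat.Primality using (Prime; prime⇒nonTrivial)
open import Data.Integer as ℤ
  using (ℤ; +_; -[1+_]; -_; _+_; _-_; _<_; _≤_; _<?_; _⊔_; ∣_∣; +<+; -<+; -<-; +≤+; -≤+)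
import Data.Integer.Properties as ℤₚ
open import Data.Product using (Σ; _×_; _,_; proj₁; proj₂; ∃)
open import Data.Unit using (tt)
open import Function using (const)
open import Relation.Binary.Bundles using (Setoid)
import Relation.Binary.Reasoning.Setoid as SetoidReasoning
open import Relation.Nullary using (¬_; yes; no; contradiction)
open import Relation.Binary.PropositionalEquality as ≡ using (_≡_; refl; cong; cong₂; subst)

private variable
  p : ℕ
  s : Space
  i j k : ℤ

<+1⇒≤ : i < j + + 1 → i ≤ j
<+1⇒≤ {i} {j} i<j+1 = subst (i ≤_) (ℤₚ.pred-suc j)
  (ℤₚ.i<j⇒i≤pred[j] (subst (i <_) (ℤₚ.+-comm j (+ 1)) i<j+1))

i≤+∣i∣ : ∀ i → i ≤ + ∣ i ∣
i≤+∣i∣ (+ n) = ℤₚ.≤-refl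
i≤+∣i∣ -[1+ n ] = -≤+

+-cancelʳ-< : ∀ k → i + k < j + k → i < j
+-cancelʳ-< k i+k<j+k = ℤₚ.≰⇒> (λ j≤i → ℤₚ.<⇒≱ i+k<j+k (ℤₚ.+-monoˡ-≤ k j≤i))

+∣i+m∣-m≡i : ∀ m → - (+ m) ≤ i → + ∣ i + + m ∣ - + m ≡ i
+∣i+m∣-m≡i {i} m -m≤i = begin
  + ∣ i + + m ∣ - + m   ≡⟨ cong (_- + m) (ℤₚ.0≤i⇒+∣i∣≡i 0≤i+m) ⟩
  i + + m - + m         ≡⟨ ℤₚ.+-assoc i (+ m) (- + m) ⟩
  i + (+ m - + m)       ≡⟨ cong (_+_ i) (ℤₚ.+-inverseʳ (+ m)) ⟩
  i + + 0               ≡⟨ ℤₚ.+-identityʳ i ⟩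
  i                     ∎
  where
  open ≡.≡-Reasoning
  0≤i+m : + 0 ≤ i + + m
  0≤i+m = subst (_≤ i + + m) (ℤₚ.+-inverseˡ (+ m)) (ℤₚ.+-monoˡ-≤ (+ m) -m≤i)

+≮-+ : ∀ m n → ¬ (+ n < - (+ m))
+≮-+ zero n (+<+ ())
+≮-+ (suc m) n ()

-[1+suc]<-suc⇒ : ∀ {n} b → -[1+ suc n ] < - (+ suc b) → -[1+ n ] < - (+ b)
-[1+suc]<-suc⇒ zero _ = -<+
-[1+suc]<-suc⇒ (suc b) (-<- (s≤s b<n)) = -<- b<n

1<2 : + 1 < + 2
1<2 = +<+ ℕₚ.≤-refl

≈-refl : {x : X p s} → x ≈ x
≈-refl i = refl

≈-sym : {x y : X p s} → x ≈ y → y ≈ x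
≈-sym x≈y i = ≡.sym (x≈y i)

≈-trans : {x y z : X p s} → x ≈ y → y ≈ z → x ≈ z
≈-trans x≈y y≈z i = ≡.trans (x≈y i) (y≈z i)

≈-setoid : ℕ → Space → Setoid _ _
≈-setoid p s = record
  { Carrier = X p s
  ; _≈_ = _≈_
  ; isEquivalence = record
    { refl = λ {x} → ≈-refl {x = x}
    ; sym = λ {x} {y} → ≈-sym {x = x} {y}
    ; trans = λ {x} {y} {z} → ≈-trans {x = x} {y} {z}
    }
  }

module ≈-Reasoning {p} {s} = SetoidReasoning (≈-setoid p s)

≈[]-sym : {x y : X p s} → x ≈[ k ] y → y ≈[ k ] x
≈[]-sym x≈y i i<k = ≡.sym (x≈y i i<k)

≈[]-weaken : {x y : X p s} → j ≤ k → x ≈[ k ] y → x ≈[ j ] y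
≈[]-weaken j≤k x≈y i i<j = x≈y i (ℤₚ.<-≤-trans i<j j≤k)

≈⇒≈[] : {x y : X p s} → x ≈ y → x ≈[ k ] y
≈⇒≈[] x≈y i _ = x≈y i

≈[]-respʳ : {x y z : X p s} → y ≈ z → x ≈[ k ] y → x ≈[ k ] z
≈[]-respʳ y≈z x≈y i i<k = ≡.trans (x≈y i i<k) (y≈z i)

≈[]-respˡ : {x y z : X p s} → x ≈ y → y ≈[ k ] z → x ≈[ k ] z
≈[]-respˡ x≈y y≈z i i<k = ≡.trans (x≈y i) (y≈z i i<k)

small⇒≈[] : {x y : X p s} → small k x → small k y → x ≈[ k ] y
small⇒≈[] x≈0 y≈0 i i<k = ≡.trans (x≈0 i i<k) (≡.sym (y≈0 i i<k))

small-weaken : {x : X p s} → j ≤ k → small k x → small j x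
small-weaken j≤k x≈0 i i<j = x≈0 i (ℤₚ.<-≤-trans i<j j≤k)

lipschitz-weaken : {φ : X p s → X p s} → j ≤ k → LipLe k φ → LipLe j φ
lipschitz-weaken {φ = φ} j≤k φ-lip x y i x≈y =
  ≈[]-weaken {x = φ x} {φ y} (ℤₚ.+-monoʳ-≤ i j≤k) (φ-lip x y i x≈y)

continuous-const : (c : X p s) → Continuous (const c)
continuous-const c x k = k , λ _ _ _ _ → refl

Congruent : (X p s → X p s) → Set
Congruent {p} {s} f = ∀ {x y : X p s} → x ≈ y → f x ≈ f y

continuous⇒congruent : (f : X p s → X p s) → Continuous f → Congruent f
continuous⇒congruent f f-cont {x} {y} x≈y i =
  ≡.sym (proj₂ (f-cont x (ℤ.suc i)) y (≈⇒≈[] {x = y} {x} (≈-sym {x = x} {y} x≈y)) i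
    (ℤₚ.suc[i]≤j⇒i<j ℤₚ.≤-refl))

iter-suc : ∀ {A : Set} (f : A → A) n a → iter f (suc n) a ≡ iter f n (f a)
iter-suc f zero a = refl
iter-suc f (suc n) a = cong f (iter-suc f n a)

iter-congruent : (f : X p s → X p s) → Congruent f → ∀ n → Congruent (iter f n)
iter-congruent f f-cong zero x≈y = x≈y
iter-congruent f f-cong (suc n) x≈y = f-cong (iter-congruent f f-cong n x≈y)

iter-conjugate : (f g h : X p s → X p s) → Congruent f → (∀ x → f (h x) ≈ h (g x)) →
                 ∀ n x → iter f n (h x) ≈ h (iter g n x)
iter-conjugate f g h f-cong conj zero x = ≈-refl {x = h x}
iter-conjugate f g h f-cong conj (suc n) x = begin
  f (iter f n (h x))   ≈⟨ f-cong (iter-conjugate f g h f-cong conj n x) ⟩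
  f (h (iter g n x))   ≈⟨ conj (iter g n x) ⟩
  h (g (iter g n x))   ∎
  where open ≈-Reasoning

orbit-pseudoOrbit : (f g : X p s → X p s) → (∀ x → f x ≈[ k ] g x) →
                    ∀ x → PseudoOrbit f k (λ n → iter g n x)
orbit-pseudoOrbit f g f≈g x n = f≈g (iter g n x)

LocallyInjective : (X p s → X p s) → Set
LocallyInjective {p} {s} f = ∀ (x : X p s) → ∃ λ j → ∀ y → y ≈[ j ] x → f y ≈ f x → y ≈ x

InjectiveOnBalls : ℤ → (X p s → X p s) → Set
InjectiveOnBalls {p} {s} k f = ∀ (x y : X p s) → y ≈[ k ] x → f y ≈ f x → y ≈ x

injectiveOnBalls⇒locallyInjective : {f : X p s → X p s} → InjectiveOnBalls k f → LocallyInjective f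
injectiveOnBalls⇒locallyInjective {k = k} f-inj x = k , f-inj x

locallyInjective-conjugate : (f g h : X p s → X p s) → Continuous f → Homeomorphism h →
                             (∀ x → f (h x) ≈ h (g x)) → LocallyInjective g → LocallyInjective f
locallyInjective-conjugate f g h f-cont (h-cont , h⁻¹ , h⁻¹-cont , h⁻¹∘h , h∘h⁻¹) conj g-inj x =
  δ , injectiveNear
  where
  open ≈-Reasoning
  z = h⁻¹ x
  ε = proj₁ (g-inj z)
  δ = proj₁ (h⁻¹-cont x ε)

  injectiveNear : ∀ y → y ≈[ δ ] x → f y ≈ f x → y ≈ x
  injectiveNear y y≈x fy≈fx = begin
    y           ≈⟨ h∘h⁻¹ y ⟨
    h (h⁻¹ y)   ≈⟨ continuous⇒congruent h h-cont (proj₂ (g-inj z) (h⁻¹ y) h⁻¹y≈z g-eq) ⟩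
    h z         ≈⟨ h∘h⁻¹ x ⟩
    x           ∎
    where
    h⁻¹y≈z : h⁻¹ y ≈[ ε ] z
    h⁻¹y≈z = proj₂ (h⁻¹-cont x ε) y y≈x
    hg-eq : h (g (h⁻¹ y)) ≈ h (g z)
    hg-eq = begin
      h (g (h⁻¹ y))   ≈⟨ conj (h⁻¹ y) ⟨
      f (h (h⁻¹ y))   ≈⟨ continuous⇒congruent f f-cont (h∘h⁻¹ y) ⟩
      f y             ≈⟨ fy≈fx ⟩
      f x             ≈⟨ continuous⇒congruent f f-cont (h∘h⁻¹ x) ⟨
      f (h z)         ≈⟨ conj z ⟩
      h (g z)         ∎
    g-eq : g (h⁻¹ y) ≈ g z
    g-eq = begin
      g (h⁻¹ y)         ≈⟨ h⁻¹∘h (g (h⁻¹ y)) ⟨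
      h⁻¹ (h (g (h⁻¹ y))) ≈⟨ continuous⇒congruent h⁻¹ h⁻¹-cont hg-eq ⟩
      h⁻¹ (h (g z))     ≈⟨ h⁻¹∘h (g z) ⟩
      g z               ∎

addStep-noOverflow : ∀ p a b → a ℕ.+ b ℕ.< p → addStep p a b 0 ≡ (a ℕ.+ b , 0)
addStep-noOverflow p a b a+b<p with a ℕ.+ b ℕ.+ 0 ℕ.<? p | ℕₚ.+-identityʳ (a ℕ.+ b)
... | yes _ | a+b+0≡a+b = cong (_, 0) a+b+0≡a+b
... | no a+b≮p | a+b+0≡a+b = contradiction (subst (ℕ._< p) (≡.sym a+b+0≡a+b) a+b<p) a+b≮p

module _ (p : ℕ) (a b : ℕ → ℕ) (no-overflow : ∀ n → a n ℕ.+ b n ℕ.< p) where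

  carry-noOverflow : ∀ n → carry p a b n ≡ 0
  carry-noOverflow zero = refl
  carry-noOverflow (suc n)
    rewrite carry-noOverflow n | addStep-noOverflow p (a n) (b n) (no-overflow n) = refl

  sumDigit-noOverflow : ∀ n → sumDigit p a b n ≡ a n ℕ.+ b n
  sumDigit-noOverflow n
    rewrite carry-noOverflow n | addStep-noOverflow p (a n) (b n) (no-overflow n) = refl

addDigits-noOverflow : (x y : X p s) → (∀ i → digit x i ℕ.+ digit y i ℕ.< p) →
                       ∀ i → addDigits x y i ≡ digit x i ℕ.+ digit y i
addDigits-noOverflow {p} x y no-overflow i with i <? - (+ (bound x ℕ.⊔ bound y))
... | yes i<-M =
  ≡.sym (cong₂ ℕ._+_ (low x i (below (ℕₚ.m≤m⊔n _ _))) (low y i (below (ℕₚ.m≤n⊔m _ _))))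
  where
  below : ∀ {b} → b ℕ.≤ bound x ℕ.⊔ bound y → i < - (+ b)
  below b≤M = ℤₚ.<-≤-trans i<-M (ℤₚ.neg-mono-≤ (+≤+ b≤M))
... | no i≮-M =
  ≡.trans (sumDigit-noOverflow p (shift x) (shift y) (λ n → no-overflow (+ n - + M)) ∣ i + + M ∣)
          (cong (λ j → digit x j ℕ.+ digit y j) (+∣i+m∣-m≡i M (ℤₚ.≮⇒≥ i≮-M)))
  where
  M = bound x ℕ.⊔ bound y
  shift : X p s → ℕ → ℕ
  shift z n = digit z (+ n - + M)

ifZero : {T : Set} → ℕ → T → T → T
ifZero zero a b = a
ifZero (suc _) a b = b

ifZero-elim : {T : Set} (P : T → Set) {a b : T} → ∀ c → P a → P b → P (ifZero c a b)
ifZero-elim P zero pa pb = pa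
ifZero-elim P (suc _) pa pb = pb

branch : (X p s → X p s) → (X p s → X p s) → X p s → X p s
branch A B x = ifZero (digit x (+ 1)) A B x

branch-at : (A B : X p s → X p s) {x y : X p s} →
            digit y (+ 1) ≡ digit x (+ 1) → branch A B y ≡ ifZero (digit x (+ 1)) A B y
branch-at A B {y = y} eq = cong (λ c → ifZero c A B y) eq

continuous-branch : (A B : X p s → X p s) → Continuous A → Continuous B → Continuous (branch A B)
continuous-branch {p} {s} A B A-cont B-cont x k = δ ⊔ + 2 , λ y y≈x →
  subst (λ (w : X p s) → w ≈[ k ] branch A B x)
    (≡.sym (branch-at A B {x} {y} (y≈x (+ 1) (ℤₚ.<-≤-trans 1<2 (ℤₚ.i≤j⊔i δ (+ 2))))))
    (proj₂ continuousAt-x y (≈[]-weaken {x = y} {x} (ℤₚ.i≤i⊔j δ (+ 2)) y≈x))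
  where
  continuousAt-x = ifZero-elim Continuous {A} {B} (digit x (+ 1)) A-cont B-cont x k
  δ = proj₁ continuousAt-x

branch-sup : (A B : X p s → X p s) → SupLe k A → SupLe k B → SupLe k (branch A B)
branch-sup {k = k} A B A-sup B-sup x =
  ifZero-elim (λ C → small k (C x)) {A} {B} (digit x (+ 1)) (A-sup x) (B-sup x)

branch-lipschitz : (A B : X p s → X p s) → LipLe k A → LipLe k B →
                   SupLe (+ 1 + k) A → SupLe (+ 1 + k) B → LipLe k (branch A B)
branch-lipschitz {p} {s} {k} A B A-lip B-lip A-sup B-sup x y j x≈y with + 1 <? j
... | yes 1<j =
  subst (λ (w : X p s) → branch A B x ≈[ j + k ] w)
    (≡.sym (branch-at A B {x} {y} (≡.sym (x≈y (+ 1) 1<j))))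
    (ifZero-elim (LipLe k) {A} {B} (digit x (+ 1)) A-lip B-lip x y j x≈y)
... | no 1≮j = small⇒≈[] {x = branch A B x} {branch A B y}
  (small-weaken {x = branch A B x} j+k≤1+k (branch-sup A B A-sup B-sup x))
  (small-weaken {x = branch A B y} j+k≤1+k (branch-sup A B A-sup B-sup y))
  where
  j+k≤1+k : j + k ≤ + 1 + k
  j+k≤1+k = ℤₚ.+-monoˡ-≤ k (ℤₚ.≮⇒≥ 1≮j)

branch-injectiveOnBalls : (A B : X p s → X p s) →
                          InjectiveOnBalls (+ 2) A → InjectiveOnBalls (+ 2) B →
                          InjectiveOnBalls (+ 2) (branch A B)
branch-injectiveOnBalls {p} {s} A B A-inj B-inj x y y≈x By≈Bx =
  ifZero-elim (λ C → C y ≈ C x → y ≈ x) {A} {B} (digit x (+ 1)) (A-inj x y y≈x) (B-inj x y y≈x)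
    (subst (λ (w : X p s) → w ≈ branch A B x) (branch-at A B {x} {y} (y≈x (+ 1) 1<2)) By≈Bx)

branch-isSum : (A φ A′ B ψ B′ : X p s → X p s) → IsSum A φ A′ → IsSum B ψ B′ →
               IsSum (branch A B) (branch φ ψ) (branch A′ B′)
branch-isSum A φ A′ B ψ B′ A-sum B-sum x with digit x (+ 1)
... | zero = A-sum x
... | suc _ = B-sum x

indicator : ℕ → ℕ → ℕ
indicator zero zero = 1
indicator zero (suc _) = 0
indicator (suc m) zero = 0
indicator (suc m) (suc n) = indicator m n

indicator≤1 : ∀ m n → indicator m n ℕ.≤ 1
indicator≤1 zero zero = ℕₚ.≤-refl
indicator≤1 zero (suc _) = z≤n
indicator≤1 (suc m) zero = z≤n
indicator≤1 (suc m) (suc n) = indicator≤1 m n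

indicator-self : ∀ m → indicator m m ≡ 1
indicator-self zero = refl
indicator-self (suc m) = indicator-self m

indicator-< : ∀ {m n} → n ℕ.< m → indicator m n ≡ 0
indicator-< {suc m} {zero} _ = refl
indicator-< {suc m} {suc n} (s≤s n<m) = indicator-< n<m

padZeros : ℕ → (ℕ → ℕ) → ℕ → ℕ
padZeros zero a n = a n
padZeros (suc M) a zero = 0
padZeros (suc M) a (suc n) = padZeros M a n

padZeros-< : ∀ M a {n} → n ℕ.< M → padZeros M a n ≡ 0
padZeros-< (suc M) a {zero} _ = refl
padZeros-< (suc M) a {suc n} (s≤s n<M) = padZeros-< M a n<M

padZeros-≥ : ∀ M a {n} → M ℕ.≤ n → padZeros M a n ≡ a (n ℕ.∸ M)
padZeros-≥ zero a _ = refl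
padZeros-≥ (suc M) a {suc n} (s≤s M≤n) = padZeros-≥ M a M≤n

padZeros-+ : ∀ M a n → padZeros M a (M ℕ.+ n) ≡ a n
padZeros-+ zero a n = refl
padZeros-+ (suc M) a n = padZeros-+ M a n

padZeros<p : ∀ {p} M {a} → 0 ℕ.< p → (∀ n → a n ℕ.< p) → ∀ n → padZeros M a n ℕ.< p
padZeros<p zero 0<p a<p n = a<p n
padZeros<p (suc M) 0<p a<p zero = 0<p
padZeros<p (suc M) 0<p a<p (suc n) = padZeros<p M 0<p a<p n

-- R x = p·{x} + p²·[x] for the fractional part {x} and the integral part [x] of x,
-- so position 1 of R x is always empty.
contractDigit : (ℤ → ℕ) → ℤ → ℕ
contractDigit d (+ zero) = d -[1+ zero ]
contractDigit d (+ suc zero) = 0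
contractDigit d (+ suc (suc n)) = d (+ n)
contractDigit d -[1+ n ] = d -[1+ suc n ]

expandDigit : Space → (ℤ → ℕ) → ℤ → ℕ
expandDigit s d (+ n) = d (+ suc (suc n))
expandDigit ℤp d -[1+ n ] = 0
expandDigit ℚp d -[1+ zero ] = d (+ 0)
expandDigit ℚp d -[1+ suc n ] = d -[1+ n ]

contractDigit-zeros : ∀ i → contractDigit (const 0) i ≡ 0
contractDigit-zeros (+ zero) = refl
contractDigit-zeros (+ suc zero) = refl
contractDigit-zeros (+ suc (suc n)) = refl
contractDigit-zeros -[1+ n ] = refl

expandDigit-zeros : ∀ s i → expandDigit s (const 0) i ≡ 0
expandDigit-zeros s (+ n) = refl
expandDigit-zeros ℤp -[1+ n ] = refl
expandDigit-zeros ℚp -[1+ zero ] = refl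
expandDigit-zeros ℚp -[1+ suc n ] = refl

expandDigit-contractDigit : ∀ s d → Integral s d → ∀ i → expandDigit s (contractDigit d) i ≡ d i
expandDigit-contractDigit s d _ (+ n) = refl
expandDigit-contractDigit ℤp d d-integral -[1+ n ] = ≡.sym (d-integral _ -<+)
expandDigit-contractDigit ℚp d _ -[1+ zero ] = refl
expandDigit-contractDigit ℚp d _ -[1+ suc n ] = refl

contractDigit-contraction : ∀ {d e} → d ≈d[ j ] e → contractDigit d ≈d[ j + + 1 ] contractDigit e
contractDigit-contraction {j = j} d≈e i i<j+1 = agree i (<+1⇒≤ i<j+1)
  where
  agree : ∀ i → i ≤ j → contractDigit _ i ≡ contractDigit _ i
  agree (+ zero) i≤j = d≈e _ (ℤₚ.<-≤-trans -<+ i≤j)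
  agree (+ suc zero) i≤j = refl
  agree (+ suc (suc n)) i≤j = d≈e _ (ℤₚ.<-≤-trans (+<+ (ℕₚ.m<n+m n ℕ.z<s)) i≤j)
  agree -[1+ n ] i≤j = d≈e _ (ℤₚ.<-≤-trans (-<- ℕₚ.≤-refl) i≤j)

expandDigit-uniformlyContinuous : ∀ s {d e} k → d ≈d[ + (2 ℕ.+ ∣ k ∣) ] e →
                                  expandDigit s d ≈d[ k ] expandDigit s e
expandDigit-uniformlyContinuous s k d≈e (+ n) (+<+ n<k) = d≈e _ (+<+ (s≤s (s≤s n<k)))
expandDigit-uniformlyContinuous ℤp k d≈e -[1+ n ] _ = refl
expandDigit-uniformlyContinuous ℚp k d≈e -[1+ zero ] _ = d≈e _ (+<+ ℕ.z<s)
expandDigit-uniformlyContinuous ℚp k d≈e -[1+ suc n ] _ = d≈e _ -<+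

module Construction {p : ℕ} (1<p : 1 ℕ.< p) (s : Space) where

  0<p : 0 ℕ.< p
  0<p = ℕₚ.<-trans ℕ.z<s 1<p

  -- Built from `const 0` rather than with integralPoint, so that `small k x` is literally
  -- `x ≈[ k ] 0ₓ`.
  0ₓ : X p s
  0ₓ = mkX (const 0) (const 0<p) 0 (λ _ _ → refl) (zeros-integral s)
    where
    zeros-integral : ∀ s → Integral s (const 0)
    zeros-integral ℤp _ _ = refl
    zeros-integral ℚp = tt

  integralPoint : (a : ℕ → ℕ) → (∀ n → a n ℕ.< p) → X p s
  integralPoint a a<p = mkX digits digits<p 0 digits-low (digits-integral s)
    where
    digits : ℤ → ℕ
    digits (+ n) = a n
    digits -[1+ n ] = 0
    digits<p : ∀ i → digits i ℕ.< p
    digits<p (+ n) = a<p n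
    digits<p -[1+ n ] = 0<p
    digits-low : ∀ i → i < - (+ 0) → digits i ≡ 0
    digits-low -[1+ n ] _ = refl
    digits-low (+ n) (+<+ ())
    digits-integral : ∀ s → Integral s digits
    digits-integral ℤp -[1+ n ] _ = refl
    digits-integral ℤp (+ n) (+<+ ())
    digits-integral ℚp = tt

  indicator<p : ∀ m n → indicator m n ℕ.< p
  indicator<p m n = ℕₚ.≤-<-trans (indicator≤1 m n) 1<p

  ϖ : X p s
  ϖ = integralPoint (indicator 1) (indicator<p 1)

  -- ϖ + p²⁺ᴺ: the two digit sequences have disjoint supports, so their ⊔ is their sum.
  perturbedϖ : ℕ → X p s
  perturbedϖ N = integralPoint (λ n → indicator 1 n ℕ.⊔ indicator (2 ℕ.+ N) n)
    (λ n → ℕₚ.≤-<-trans (ℕₚ.⊔-lub (indicator≤1 1 n) (indicator≤1 (2 ℕ.+ N) n)) 1<p)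

  perturbedϖ-close : ∀ N → perturbedϖ N ≈[ + (2 ℕ.+ N) ] ϖ
  perturbedϖ-close N (+ n) (+<+ n<2+N) =
    ≡.trans (cong (indicator 1 n ℕ.⊔_) (indicator-< n<2+N)) (ℕₚ.⊔-identityʳ _)
  perturbedϖ-close N -[1+ n ] _ = refl

  perturbedϖ-≉ : ∀ N → ¬ perturbedϖ N ≈ ϖ
  perturbedϖ-≉ N perturbed≈ϖ =
    ℕₚ.1+n≢0 (≡.trans (≡.sym (indicator-self N)) (perturbed≈ϖ (+ (2 ℕ.+ N))))

  ϖ-small : small (+ 1) ϖ
  ϖ-small (+ zero) _ = refl
  ϖ-small (+ suc n) (+<+ (s≤s ()))
  ϖ-small -[1+ n ] _ = refl

  contract : X p s → X p s
  contract x =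
    mkX (contractDigit (digit x)) contract<p (bound x) contract-low
      (contract-integral s (integral x))
    where
    contract<p : ∀ i → contractDigit (digit x) i ℕ.< p
    contract<p (+ zero) = digit<p x _
    contract<p (+ suc zero) = 0<p
    contract<p (+ suc (suc n)) = digit<p x _
    contract<p -[1+ n ] = digit<p x _
    contract-low : ∀ i → i < - (+ bound x) → contractDigit (digit x) i ≡ 0
    contract-low (+ n) +n<-b = contradiction +n<-b (+≮-+ (bound x) n)
    contract-low -[1+ n ] i<-b = low x _ (ℤₚ.<-trans (-<- ℕₚ.≤-refl) i<-b)
    contract-integral : ∀ s → Integral s (digit x) → Integral s (contractDigit (digit x))
    contract-integral ℤp x-integral -[1+ n ] _ = x-integral _ -<+
    contract-integral ℤp x-integral (+ n) (+<+ ())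
    contract-integral ℚp _ = tt

  expand : X p s → X p s
  expand x =
    mkX (expandDigit s (digit x)) (expand<p s) (suc (bound x)) (expand-low s) (expand-integral s)
    where
    expand<p : ∀ s i → expandDigit s (digit x) i ℕ.< p
    expand<p s (+ n) = digit<p x _
    expand<p ℤp -[1+ n ] = 0<p
    expand<p ℚp -[1+ zero ] = digit<p x _
    expand<p ℚp -[1+ suc n ] = digit<p x _
    expand-low : ∀ s i → i < - (+ suc (bound x)) → expandDigit s (digit x) i ≡ 0
    expand-low ℤp -[1+ n ] _ = refl
    expand-low ℚp -[1+ zero ] (-<- ())
    expand-low ℚp -[1+ suc n ] i<-b = low x _ (-[1+suc]<-suc⇒ (bound x) i<-b)
    expand-integral : ∀ s → Integral s (expandDigit s (digit x))
    expand-integral ℤp -[1+ n ] _ = refl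
    expand-integral ℤp (+ n) (+<+ ())
    expand-integral ℚp = tt

  scaledIntPart : ℕ → X p s → X p s
  scaledIntPart M x =
    integralPoint (padZeros M (λ n → digit x (+ n))) (padZeros<p M 0<p (λ n → digit<p x (+ n)))

  expand-contract : ∀ x → expand (contract x) ≈ x
  expand-contract x = expandDigit-contractDigit s (digit x) (integral x)

  contract-contraction : Contraction contract
  contract-contraction x y j = contractDigit-contraction

  contract-small : ∀ {x} → small k x → small (+ 1 + k) (contract x)
  contract-small {k} {x} x-small =
    subst (λ j → contract x ≈[ j ] 0ₓ) (ℤₚ.+-comm k (+ 1))
      (≈[]-respʳ {x = contract x} {contract 0ₓ} {0ₓ} contractDigit-zeros
        (contract-contraction x 0ₓ k x-small))

  contract^-small : ∀ K → small (+ suc K) (iter contract K ϖ)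
  contract^-small zero = ϖ-small
  contract^-small (suc K) = contract-small {+ suc K} {iter contract K ϖ} (contract^-small K)

  continuous-expand : Continuous expand
  continuous-expand x k = + (2 ℕ.+ ∣ k ∣) , λ y → expandDigit-uniformlyContinuous s k

  expand-injectiveOnBalls : InjectiveOnBalls (+ 2) expand
  expand-injectiveOnBalls x y y≈x _ -[1+ n ] = y≈x _ -<+
  expand-injectiveOnBalls x y y≈x _ (+ zero) = y≈x _ (+<+ ℕ.z<s)
  expand-injectiveOnBalls x y y≈x _ (+ suc zero) = y≈x _ 1<2
  expand-injectiveOnBalls x y _ expand-y≈x (+ suc (suc n)) = expand-y≈x (+ n)

  scaledIntPart-small : ∀ M x → small (+ M) (scaledIntPart M x)
  scaledIntPart-small M x (+ n) (+<+ n<M) = padZeros-< M _ n<M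
  scaledIntPart-small M x -[1+ n ] _ = refl

  scaledIntPart-lipschitz : ∀ M → LipLe (+ M) (scaledIntPart M)
  scaledIntPart-lipschitz M x y j x≈y -[1+ n ] _ = refl
  scaledIntPart-lipschitz M x y j x≈y (+ n) n<j+M with n ℕ.<? M
  ... | yes n<M = ≡.trans (padZeros-< M _ n<M) (≡.sym (padZeros-< M _ n<M))
  ... | no n≮M = begin
    padZeros M (λ n → digit x (+ n)) n   ≡⟨ padZeros-≥ M _ M≤n ⟩
    digit x (+ (n ℕ.∸ M))               ≡⟨ x≈y _ n-M<j ⟩
    digit y (+ (n ℕ.∸ M))               ≡⟨ padZeros-≥ M _ M≤n ⟨
    padZeros M (λ n → digit y (+ n)) n   ∎
    where
    open ≡.≡-Reasoning
    M≤n = ℕₚ.≮⇒≥ n≮M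
    n-M<j : + (n ℕ.∸ M) < j
    n-M<j = +-cancelʳ-< (+ M) (subst (_< j + + M) (cong +_ (≡.sym (ℕₚ.m∸n+n≡m M≤n))) n<j+M)

  scaledIntPart-injectiveOnBalls : ∀ M → InjectiveOnBalls (+ 0) (scaledIntPart M)
  scaledIntPart-injectiveOnBalls M x y y≈x _ -[1+ n ] = y≈x _ -<+
  scaledIntPart-injectiveOnBalls M x y _ scaled-y≈x (+ n) = begin
    digit y (+ n)                               ≡⟨ padZeros-+ M _ n ⟨
    padZeros M (λ n → digit y (+ n)) (M ℕ.+ n)   ≡⟨ scaled-y≈x (+ (M ℕ.+ n)) ⟩
    padZeros M (λ n → digit x (+ n)) (M ℕ.+ n)   ≡⟨ padZeros-+ M _ n ⟩
    digit x (+ n)                               ∎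
    where open ≡.≡-Reasoning

  f : X p s → X p s
  f = branch expand (const 0ₓ)

  continuous-f : Continuous f
  continuous-f = continuous-branch expand (const 0ₓ) continuous-expand (continuous-const 0ₓ)

  f-congruent : Congruent f
  f-congruent = continuous⇒congruent f continuous-f

  f-escapes : ∀ x {c} → digit x (+ 1) ≡ suc c → ∀ n → iter f (suc n) x ≈ 0ₓ
  f-escapes x x₁≡1+c zero i rewrite x₁≡1+c = refl
  f-escapes x x₁≡1+c (suc n) =
    ≈-trans {x = f (iter f (suc n) x)} {f 0ₓ} {0ₓ}
      (f-congruent {iter f (suc n) x} {0ₓ} (f-escapes x x₁≡1+c n)) (expandDigit-zeros s)

  f-no-return : ∀ {x} → x ≈[ + 2 ] ϖ → ∀ n → ¬ iter f (suc n) x ≈[ + 2 ] ϖ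
  f-no-return {x} x≈ϖ n returned =
    ℕₚ.0≢1+n (≡.trans (≡.sym (f-escapes x (x≈ϖ (+ 1) 1<2) n (+ 1))) (returned (+ 1) 1<2))

  f-not-locallyInjective : ¬ LocallyInjective f
  f-not-locallyInjective f-inj =
    perturbedϖ-≉ N (proj₂ (f-inj ϖ) (perturbedϖ N) close λ _ → refl)
    where
    δ = proj₁ (f-inj ϖ)
    N = ∣ δ ∣
    close : perturbedϖ N ≈[ δ ] ϖ
    close = ≈[]-weaken {x = perturbedϖ N} {ϖ} (ℤₚ.≤-trans (i≤+∣i∣ δ) (+≤+ (ℕₚ.m≤n+m N 2)))
              (perturbedϖ-close N)

  redirected : ℕ → X p s → X p s
  redirected K = branch expand (const (iter contract K ϖ))

  f≈[]redirected : ∀ k (x : X p s) → f x ≈[ k ] redirected ∣ k ∣ x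
  f≈[]redirected k x with digit x (+ 1)
  ... | zero = λ _ _ → refl
  ... | suc _ = small⇒≈[] {x = 0ₓ} {iter contract ∣ k ∣ ϖ} (λ _ _ → refl)
    (small-weaken {x = iter contract ∣ k ∣ ϖ} (ℤₚ.≤-trans (i≤+∣i∣ k) (+≤+ (ℕₚ.n≤1+n _)))
      (contract^-small ∣ k ∣))

  continuous-redirected : ∀ K → Continuous (redirected K)
  continuous-redirected K =
    continuous-branch expand _ continuous-expand (continuous-const (iter contract K ϖ))

  iter-redirected-contract : ∀ K m → iter (redirected K) m (iter contract m ϖ) ≈ ϖ
  iter-redirected-contract K zero = ≈-refl {x = ϖ}
  iter-redirected-contract K (suc m) = begin
    iter g (suc m) (contract (iter contract m ϖ))     ≡⟨ iter-suc g m _ ⟩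
    iter g m (expand (contract (iter contract m ϖ)))
      ≈⟨ iter-congruent g g-congruent m (expand-contract (iter contract m ϖ)) ⟩
    iter g m (iter contract m ϖ)                      ≈⟨ iter-redirected-contract K m ⟩
    ϖ                                                 ∎
    where
    open ≈-Reasoning
    g = redirected K
    g-congruent = continuous⇒congruent g (continuous-redirected K)

  redirected-periodic : ∀ K → iter (redirected K) (suc K) ϖ ≈ ϖ
  redirected-periodic K = begin
    iter (redirected K) (suc K) ϖ                 ≡⟨ iter-suc (redirected K) K ϖ ⟩
    iter (redirected K) K (iter contract K ϖ)     ≈⟨ iter-redirected-contract K K ⟩
    ϖ                                             ∎
    where open ≈-Reasoning

  ¬shadowing : ¬ Shadowing f
  ¬shadowing shadowing with shadowing (+ 2)
  ... | k , shadow =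
    unshadowed (shadow (λ n → iter g n ϖ) (orbit-pseudoOrbit f g (f≈[]redirected k) ϖ))
    where
    K = ∣ k ∣
    g = redirected K
    unshadowed : ¬ ∃ λ x → ∀ n → iter g n ϖ ≈[ + 2 ] iter f n x
    unshadowed (x , traced) = f-no-return x≈ϖ K fᴷ⁺¹x≈ϖ
      where
      x≈ϖ : x ≈[ + 2 ] ϖ
      x≈ϖ = ≈[]-sym {x = ϖ} {x} (traced 0)
      fᴷ⁺¹x≈ϖ : iter f (suc K) x ≈[ + 2 ] ϖ
      fᴷ⁺¹x≈ϖ = ≈[]-respʳ {x = iter f (suc K) x} {iter g (suc K) ϖ} {ϖ} (redirected-periodic K)
        (≈[]-sym {x = iter g (suc K) ϖ} {iter f (suc K) x} (traced (suc K)))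

  ¬topologicallyStable : ¬ TopologicallyStable f
  ¬topologicallyStable stable with stable (+ 2)
  ... | k , stable-k
    with stable-k (redirected ∣ k ∣) (continuous-redirected ∣ k ∣) (f≈[]redirected k)
  ... | h , h-cont , h≈id , conj =
    f-no-return {h ϖ} (h≈id ϖ) K (≈[]-respˡ {x = iter f (suc K) (h ϖ)} {h ϖ} {ϖ} fᴷ⁺¹hϖ≈hϖ (h≈id ϖ))
    where
    K = ∣ k ∣
    fᴷ⁺¹hϖ≈hϖ : iter f (suc K) (h ϖ) ≈ h ϖ
    fᴷ⁺¹hϖ≈hϖ = ≈-trans {x = iter f (suc K) (h ϖ)} {h (iter (redirected K) (suc K) ϖ)} {h ϖ}
      (iter-conjugate f (redirected K) h f-congruent conj (suc K) ϖ)
      (continuous⇒congruent h h-cont (redirected-periodic K))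

  isSum-identityʳ : (A : X p s → X p s) → IsSum A (const 0ₓ) A
  isSum-identityʳ A x i =
    ≡.sym (≡.trans (addDigits-noOverflow (A x) 0ₓ no-overflow i) (ℕₚ.+-identityʳ _))
    where
    no-overflow : ∀ i → digit (A x) i ℕ.+ 0 ℕ.< p
    no-overflow i = subst (ℕ._< p) (≡.sym (ℕₚ.+-identityʳ _)) (digit<p (A x) i)

  isSum-identityˡ : (B : X p s → X p s) → IsSum (const 0ₓ) B B
  isSum-identityˡ B x i = ≡.sym (addDigits-noOverflow 0ₓ (B x) (digit<p (B x)) i)

  perturbation perturbed : ℤ → X p s → X p s
  perturbation k = branch (const 0ₓ) (scaledIntPart (suc ∣ k ∣))
  perturbed k = branch expand (scaledIntPart (suc ∣ k ∣))

  perturbation-lipBall : ∀ k → LipBall k (perturbation k)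
  perturbation-lipBall k =
    branch-lipschitz (const 0ₓ) (scaledIntPart M) (λ _ _ _ _ _ _ → refl)
      (lipschitz-weaken {φ = scaledIntPart M} k≤M (scaledIntPart-lipschitz M))
      (λ _ _ _ → refl)
      (λ x → small-weaken {x = scaledIntPart M x} 1+k≤M (scaledIntPart-small M x)) ,
    branch-sup (const 0ₓ) (scaledIntPart M) (λ _ _ _ → refl)
      (λ x → small-weaken {x = scaledIntPart M x} k≤M (scaledIntPart-small M x))
    where
    M = suc ∣ k ∣
    1+k≤M : + 1 + k ≤ + M
    1+k≤M = ℤₚ.+-monoʳ-≤ (+ 1) (i≤+∣i∣ k)
    k≤M : k ≤ + M
    k≤M = ℤₚ.≤-trans (ℤₚ.i≤j+i k (+ 1)) 1+k≤M

  perturbed-isSum : ∀ k → IsSum f (perturbation k) (perturbed k)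
  perturbed-isSum k =
    branch-isSum expand (const 0ₓ) expand (const 0ₓ) (scaledIntPart M) (scaledIntPart M)
      (isSum-identityʳ expand) (isSum-identityˡ (scaledIntPart M))
    where M = suc ∣ k ∣

  perturbed-injectiveOnBalls : ∀ k → InjectiveOnBalls (+ 2) (perturbed k)
  perturbed-injectiveOnBalls k =
    branch-injectiveOnBalls expand (scaledIntPart M) expand-injectiveOnBalls
      (λ x y y≈x → scaledIntPart-injectiveOnBalls M x y (≈[]-weaken {x = y} {x} (+≤+ z≤n) y≈x))
    where M = suc ∣ k ∣

  ¬lipStructurallyStable : ¬ LipStructurallyStable f
  ¬lipStructurallyStable (k , stable)
    with stable (perturbation k) (perturbed k) (perturbation-lipBall k) (perturbed-isSum k)
  ... | h , h-homeo , conj = f-not-locallyInjective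
    (locallyInjective-conjugate f (perturbed k) h continuous-f h-homeo conj
      (injectiveOnBalls⇒locallyInjective {k = + 2} {perturbed k} (perturbed-injectiveOnBalls k)))

theorem2 : (p : ℕ) → Prime p → (s : Space) →
    Σ (X p s → X p s) λ f → Continuous f ×
      (Σ (X p s → X p s) λ R → Contraction R × (∀ x → f (R x) ≈ x)) ×
      ¬ Shadowing f × ¬ LipStructurallyStable f × ¬ TopologicallyStable f
theorem2 p p-prime s =
  f , continuous-f , (contract , contract-contraction , expand-contract) ,
  ¬shadowing , ¬lipStructurallyStable , ¬topologicallyStable
  where open Construction (ℕ.nonTrivial⇒n>1 p {{prime⇒nonTrivial p-prime}}) s
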